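{- For a positive integer $n$, the number $m(n)$ is odd if and only if $n$ is squarefree.
   Context: For an integer $n\ge2$, $m(n)$ denotes the number of ordered factorizations of $n$ into factors larger than $1$, i.e. the number of finite sequences $(d_1,\dots,d_r)$, $r\ge 1$, of integers $d_i\ge 2$ with $d_1\cdots d_r=n$; we use the convention $m(1)=1$. -}

module Defs where

open import Data.Nat using (ℕ; zero; suc; _≟_; _∸_; _+_; _*_)
open import Data.Nat.Divisibility using (_∣_)
open import Data.List using (List; []; _∷_; map; concatMap; filter; length; upTo; _++_)
open import Data.Nat.ListAction using (product)
open import Relation.Binary.PropositionalEquality using (_≡_)

listsOfLength : ℕ → ℕ → List (List ℕ)
listsOfLength n zero    = [] ∷ []
listsOfLength n (suc r) =
  concatMap (λ d → map (d ∷_) (listsOfLength n r)) (map (2 +_) (upTo (n ∸ 1)))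

listsUpTo : ℕ → ℕ → List (List ℕ)
listsUpTo n zero    = listsOfLength n zero
listsUpTo n (suc r) = listsUpTo n r ++ listsOfLength n (suc r)

-- m n = number of ordered factorizations of n: finite sequences of integers ≥ 2
-- whose product is n. Every such sequence has length ≤ n and entries ≤ n, so it
-- suffices to enumerate listsUpTo n n. The empty sequence (product 1) is counted
-- only for n = 1, giving the convention m 1 = 1.
m : ℕ → ℕ
m n = length (filter (λ l → product l ≟ n) (listsUpTo n n))

SquareFree : ℕ → Set
SquareFree n = ∀ d → d * d ∣ n → d ≡ 1

module Submission where

-- Splitting off the first factor gives m(k) = [k = 1] + Σ m(k/d), summed over the divisors
-- d ≥ 2 of k. By induction m(k/d) ≡ [k/d squarefree] (mod 2), so it remains to see that for
-- k > 1 the divisors d of k with squarefree cofactor k/d come in pairs: for a prime p ∣ k,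
-- multiplying d by p when p ∣ k/d and dividing it by p otherwise is a fixed-point-free
-- involution on them. Since m n only enumerates lists of length ≤ n with entries ≤ n, the
-- induction is over a length bound R, for every k ≤ R bounded by the entry bound B.

open import Defs
open import Level using (Level; _⊔_; 0ℓ)
open import Function.Base using (_∘_; id)
open import Function.Bundles using (_⇔_; mk⇔; Equivalence)
open import Function.Construct.Composition using (_⇔-∘_)
open import Data.Bool.Base using (if_then_else_)
open import Data.Product.Base using (∃-syntax; _×_; _,_; proj₁; proj₂)
open import Data.Sum.Base using (inj₁; inj₂; reduce)
open import Data.Nat.Base
  using (ℕ; zero; suc; _+_; _*_; _∸_; _%_; _≤_; _<_; z≤n; s≤s; NonZero; parity
        ; ≢-nonZero⁻¹; nonTrivial⇒n>1; nonTrivial⇒≢1)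
open import Data.Nat.Properties
open import Algebra.Properties.CommutativeSemigroup +-commutativeSemigroup using (interchange)
open import Data.Nat.Divisibility
open import Data.Nat.DivMod using (_/_; m*n/n≡m)
open import Data.Nat.Primality using (Prime; euclidsLemma; prime⇒nonZero; prime⇒nonTrivial)
open import Data.Nat.Primality.Factorisation using (factorise)
open import Data.Nat.ListAction using (sum; product)
open import Data.Nat.ListAction.Properties using (∈⇒∣product)
open import Data.Parity.Base as ℙ using (0ℙ; 1ℙ)
open import Data.Parity.Properties using (+-homo-+)
open import Data.List.Base using (List; []; _∷_; [_]; _++_; map; filter; length; concatMap; upTo)
open import Data.List.Properties using (length-++; filter-++; filter-none; map-cong; map-upTo)
open import Data.List.Membership.Propositional using (_∈_)
open import Data.List.Membership.Propositional.Properties using (∈-filter⁻; ∈-map⁻; ∈-upTo⁺)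
open import Data.List.Relation.Unary.Any using (here; there)
open import Data.List.Relation.Unary.All as All using (_∷_)
open import Data.List.Relation.Unary.AllPairs using (_∷_)
open import Data.List.Relation.Unary.Unique.Propositional using (Unique)
open import Data.List.Relation.Unary.Unique.Propositional.Properties using (upTo⁺)
open import Relation.Nullary using (Dec; yes; no; does; ¬_; contradiction)
open import Relation.Nullary.Decidable using (map′; _→-dec_; dec-true; dec-false)
open import Relation.Unary using (Pred; Decidable; _∖_; ｛_｝; _⊆_)
open import Relation.Unary.Properties using (_∩?_; ∁?)
open import Relation.Binary.Definitions using (DecidableEquality)
open import Relation.Binary.PropositionalEquality
  using (_≡_; _≢_; refl; sym; trans; cong; cong₂; subst; subst₂; module ≡-Reasoning)

private variable
  a ℓ ℓ′ : Level
  A B : Set a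

module _ {P : Pred A ℓ} (P? : Decidable P) where

  count : List A → ℕ
  count = length ∘ filter P?

  count-++ : ∀ xs ys → count (xs ++ ys) ≡ count xs + count ys
  count-++ xs ys = trans (cong length (filter-++ P? xs ys)) (length-++ (filter P? xs))

  count-∷ : ∀ x xs → count (x ∷ xs) ≡ count [ x ] + count xs
  count-∷ x = count-++ [ x ]

  count-yes : ∀ {x} → P x → count [ x ] ≡ 1
  count-yes {x} Px with P? x
  ... | yes _  = refl
  ... | no ¬Px = contradiction Px ¬Px

  count-no : ∀ {x} → ¬ P x → count [ x ] ≡ 0
  count-no {x} ¬Px with P? x
  ... | yes Px = contradiction Px ¬Px
  ... | no _   = refl

  count-none : ∀ {xs} → (∀ {x} → x ∈ xs → ¬ P x) → count xs ≡ 0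
  count-none ¬P = cong length (filter-none P? (All.tabulate ¬P))

  count≡sum : ∀ xs → count xs ≡ sum (map (λ x → count [ x ]) xs)
  count≡sum []       = refl
  count≡sum (x ∷ xs) = trans (count-∷ x xs) (cong (count [ x ] +_) (count≡sum xs))

  count-concatMap : ∀ (f : B → List A) xs → count (concatMap f xs) ≡ sum (map (count ∘ f) xs)
  count-concatMap f []       = refl
  count-concatMap f (x ∷ xs) =
    trans (count-++ (f x) (concatMap f xs)) (cong (count (f x) +_) (count-concatMap f xs))

  count≡suc⇒∃ : ∀ xs {c} → count xs ≡ suc c → ∃[ x ] x ∈ xs × P x
  count≡suc⇒∃ xs #xs≡1+c with filter P? xs in filter≡
  ... | x ∷ _ = x , ∈-filter⁻ P? (subst (x ∈_) (sym filter≡) (here refl))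

module _ {P : Pred A ℓ} {Q : Pred B ℓ′} (P? : Decidable P) (Q? : Decidable Q) where

  count-[]-⇔ : ∀ {x y} → P x ⇔ Q y → count P? [ x ] ≡ count Q? [ y ]
  count-[]-⇔ {x} {y} P⇔Q with P? x | Q? y
  ... | yes _  | yes _  = refl
  ... | yes Px | no ¬Qy = contradiction (Equivalence.to P⇔Q Px) ¬Qy
  ... | no ¬Px | yes Qy = contradiction (Equivalence.from P⇔Q Qy) ¬Px
  ... | no _   | no _   = refl

module _ {P : Pred A ℓ} {Q : Pred A ℓ′} (P? : Decidable P) (Q? : Decidable Q) where

  count-cong : ∀ {xs} → (∀ {x} → x ∈ xs → P x ⇔ Q x) → count P? xs ≡ count Q? xs
  count-cong {[]}     _   = refl
  count-cong {x ∷ xs} P⇔Q = begin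
    count P? (x ∷ xs)              ≡⟨ count-∷ P? x xs ⟩
    count P? [ x ] + count P? xs   ≡⟨ cong₂ _+_ (count-[]-⇔ P? Q? (P⇔Q (here refl)))
                                                 (count-cong (P⇔Q ∘ there)) ⟩
    count Q? [ x ] + count Q? xs   ≡⟨ count-∷ Q? x xs ⟨
    count Q? (x ∷ xs)              ∎
    where open ≡-Reasoning

count-map : ∀ {P : Pred A ℓ} (P? : Decidable P) (g : B → A) xs →
            count P? (map g xs) ≡ count (P? ∘ g) xs
count-map P? g []       = refl
count-map P? g (x ∷ xs) = begin
  count P? (g x ∷ map g xs)                 ≡⟨ count-∷ P? (g x) (map g xs) ⟩
  count P? [ g x ] + count P? (map g xs)    ≡⟨ cong₂ _+_ (count-[]-⇔ P? (P? ∘ g) (mk⇔ id id))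
                                                         (count-map P? g xs) ⟩
  count (P? ∘ g) [ x ] + count (P? ∘ g) xs  ≡⟨ count-∷ (P? ∘ g) x xs ⟨
  count (P? ∘ g) (x ∷ xs)                   ∎
  where open ≡-Reasoning

record IsFixedPointFreeInvolutionOn {A : Set a} (P : Pred A ℓ) (f : A → A) : Set (a ⊔ ℓ) where
  field
    closed         : ∀ {x} → P x → P (f x)
    fixedPointFree : ∀ {x} → P x → f x ≢ x
    involutive     : ∀ {x} → P x → f (f x) ≡ x

module _ (_≟_ : DecidableEquality A) where

  infixl 6 _∖?_

  _∖?_ : {P : Pred A ℓ} → Decidable P → (x : A) → Decidable (P ∖ ｛ x ｝)
  P? ∖? x = P? ∩? ∁? (x ≟_)

  count-∖ : ∀ {P : Pred A ℓ} (P? : Decidable P) {x xs} → Unique xs → x ∈ xs → P x →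
            count P? xs ≡ suc (count (P? ∖? x) xs)
  count-∖ {P = P} P? {x} {x ∷ xs} (x∉xs ∷ _) (here refl) Px = begin
    count P? (x ∷ xs)                                   ≡⟨ count-∷ P? x xs ⟩
    count P? [ x ] + count P? xs                        ≡⟨ cong (_+ count P? xs) (count-yes P? Px) ⟩
    suc (count P? xs)                                   ≡⟨ cong suc (count-cong P? (P? ∖? x) keep) ⟩
    suc (count (P? ∖? x) xs)                            ≡⟨ cong (λ n → suc (n + count (P? ∖? x) xs)) x-dropped ⟨
    suc (count (P? ∖? x) [ x ] + count (P? ∖? x) xs)    ≡⟨ cong suc (count-∷ (P? ∖? x) x xs) ⟨
    suc (count (P? ∖? x) (x ∷ xs))                      ∎
    where
      open ≡-Reasoning
      x-dropped : count (P? ∖? x) [ x ] ≡ 0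
      x-dropped = count-no (P? ∖? x) λ (_ , x≢x) → x≢x refl
      keep : ∀ {y} → y ∈ xs → P y ⇔ (P ∖ ｛ x ｝) y
      keep y∈xs = mk⇔ (λ Py → Py , All.lookup x∉xs y∈xs) proj₁
  count-∖ {P = P} P? {x} {y ∷ xs} (y∉xs ∷ xs-unique) (there x∈xs) Px = begin
    count P? (y ∷ xs)                                    ≡⟨ count-∷ P? y xs ⟩
    count P? [ y ] + count P? xs                         ≡⟨ cong₂ _+_ (count-[]-⇔ P? (P? ∖? x) keep)
                                                                       (count-∖ P? xs-unique x∈xs Px) ⟩
    count (P? ∖? x) [ y ] + suc (count (P? ∖? x) xs)     ≡⟨ +-suc _ _ ⟩
    suc (count (P? ∖? x) [ y ] + count (P? ∖? x) xs)     ≡⟨ cong suc (count-∷ (P? ∖? x) y xs) ⟨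
    suc (count (P? ∖? x) (y ∷ xs))                       ∎
    where
      open ≡-Reasoning
      keep : P y ⇔ (P ∖ ｛ x ｝) y
      keep = mk⇔ (λ Py → Py , λ x≡y → All.lookup y∉xs x∈xs (sym x≡y)) proj₁

  module _ {f : A → A} {xs : List A} (xs-unique : Unique xs) where

    private
      involution-∖-orbit : ∀ {P : Pred A ℓ} {x} → IsFixedPointFreeInvolutionOn P f → P x →
                           IsFixedPointFreeInvolutionOn ((P ∖ ｛ x ｝) ∖ ｛ f x ｝) f
      involution-∖-orbit {x = x} inv Px = record
        { closed         = λ ((Py , x≢y) , fx≢y) →
            (closed Py , λ x≡fy → fx≢y (trans (cong f x≡fy) (involutive Py)))
            , λ fx≡fy → x≢y (trans (sym (involutive Px)) (trans (cong f fx≡fy) (involutive Py)))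
        ; fixedPointFree = fixedPointFree ∘ proj₁ ∘ proj₁
        ; involutive     = involutive ∘ proj₁ ∘ proj₁
        }
        where open IsFixedPointFreeInvolutionOn inv

      count-∖-orbit : ∀ {P : Pred A ℓ} (P? : Decidable P) {x} → IsFixedPointFreeInvolutionOn P f →
                      P ⊆ (_∈ xs) → P x → count P? xs ≡ 2 + count (P? ∖? x ∖? f x) xs
      count-∖-orbit P? {x} inv P⊆xs Px =
        trans (count-∖ P? xs-unique (P⊆xs Px) Px)
              (cong suc (count-∖ (P? ∖? x) xs-unique (P⊆xs (closed Px)) (closed Px , x≢fx)))
        where
          open IsFixedPointFreeInvolutionOn inv
          x≢fx = λ x≡fx → fixedPointFree Px (sym x≡fx)

      even-by-size : ∀ c {P : Pred A ℓ} (P? : Decidable P) → IsFixedPointFreeInvolutionOn P f →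
                     P ⊆ (_∈ xs) → count P? xs ≡ c → parity c ≡ 0ℙ
      even-by-size zero          _  _   _    _     = refl
      even-by-size (suc zero)    P? inv P⊆xs #P≡1
        with x , _ , Px ← count≡suc⇒∃ P? xs #P≡1
        with () ← trans (sym #P≡1) (count-∖-orbit P? inv P⊆xs Px)
      even-by-size (suc (suc c)) P? inv P⊆xs #P≡2+c
        with x , _ , Px ← count≡suc⇒∃ P? xs #P≡2+c =
        even-by-size c (P? ∖? x ∖? f x) (involution-∖-orbit inv Px) (P⊆xs ∘ proj₁ ∘ proj₁)
          (suc-injective (suc-injective (trans (sym (count-∖-orbit P? inv P⊆xs Px)) #P≡2+c)))

    involution⇒count-even : ∀ {P : Pred A ℓ} (P? : Decidable P) → IsFixedPointFreeInvolutionOn P f →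
                            P ⊆ (_∈ xs) → parity (count P? xs) ≡ 0ℙ
    involution⇒count-even P? inv P⊆xs = even-by-size _ P? inv P⊆xs refl

sum-map-+ : ∀ (f g : A → ℕ) xs → sum (map (λ x → f x + g x) xs) ≡ sum (map f xs) + sum (map g xs)
sum-map-+ f g []       = refl
sum-map-+ f g (x ∷ xs) =
  trans (cong (f x + g x +_) (sum-map-+ f g xs)) (interchange (f x) (g x) _ _)

parity-sum-cong : ∀ {f g : A → ℕ} {xs} → (∀ {x} → x ∈ xs → parity (f x) ≡ parity (g x)) →
                  parity (sum (map f xs)) ≡ parity (sum (map g xs))
parity-sum-cong {xs = []}                 _       = refl
parity-sum-cong {f = f} {g} {xs = x ∷ xs} f≈g = begin
  parity (f x + sum (map f xs))                ≡⟨ +-homo-+ (f x) _ ⟩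
  parity (f x) ℙ.+ parity (sum (map f xs))     ≡⟨ cong₂ ℙ._+_ (f≈g (here refl))
                                                              (parity-sum-cong (f≈g ∘ there)) ⟩
  parity (g x) ℙ.+ parity (sum (map g xs))     ≡⟨ +-homo-+ (g x) _ ⟨
  parity (g x + sum (map g xs))                ∎
  where open ≡-Reasoning

parity-+≡0ℙ⇒≡ : ∀ m n → parity (m + n) ≡ 0ℙ → parity n ≡ parity m
parity-+≡0ℙ⇒≡ m n parity[m+n]≡0
  with parity m | parity n | trans (sym (+-homo-+ m n)) parity[m+n]≡0
... | 0ℙ | 0ℙ | _  = refl
... | 1ℙ | 1ℙ | _  = refl
... | 0ℙ | 1ℙ | ()
... | 1ℙ | 0ℙ | ()

%2≡1⇔parity≡1ℙ : ∀ n → n % 2 ≡ 1 ⇔ parity n ≡ 1ℙ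
%2≡1⇔parity≡1ℙ zero          = mk⇔ (λ ()) (λ ())
%2≡1⇔parity≡1ℙ (suc zero)    = mk⇔ (λ _ → refl) (λ _ → refl)
%2≡1⇔parity≡1ℙ (suc (suc n)) = %2≡1⇔parity≡1ℙ n

parity-count-[]⇔ : ∀ {P : Pred A ℓ} (P? : Decidable P) x → parity (count P? [ x ]) ≡ 1ℙ ⇔ P x
parity-count-[]⇔ P? x with P? x
... | yes Px = mk⇔ (λ _ → Px) (λ _ → refl)
... | no ¬Px = mk⇔ (λ ()) (λ Px → contradiction Px ¬Px)

factors : ℕ → List ℕ
factors B = map (2 +_) (upTo (B ∸ 1))

∈-factors⁻ : ∀ {B d} → d ∈ factors B → 2 ≤ d
∈-factors⁻ d∈ with i , _ , refl ← ∈-map⁻ (2 +_) d∈ = s≤s (s≤s z≤n)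

upTo-suc≡0∷1∷factors : ∀ {B} → 1 ≤ B → upTo (suc B) ≡ 0 ∷ 1 ∷ factors B
upTo-suc≡0∷1∷factors {suc B} _ = cong (λ ds → 0 ∷ 1 ∷ ds) (sym (map-upTo (2 +_) B))

module _ {ℓ} {P : Pred (List ℕ) ℓ} (P? : Decidable P) (B : ℕ) where

  count-listsOfLength-suc : ∀ r → count P? (listsOfLength B (suc r)) ≡
                            sum (map (λ d → count (P? ∘ (d ∷_)) (listsOfLength B r)) (factors B))
  count-listsOfLength-suc r =
    trans (count-concatMap P? (λ d → map (d ∷_) (listsOfLength B r)) (factors B))
          (cong sum (map-cong (λ d → count-map P? (d ∷_) (listsOfLength B r)) (factors B)))

  count-listsUpTo-suc : ∀ R → count P? (listsUpTo B (suc R)) ≡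
                        count P? [ [] ] + sum (map (λ d → count (P? ∘ (d ∷_)) (listsUpTo B R)) (factors B))
  count-listsUpTo-suc zero =
    trans (count-++ P? [ [] ] (listsOfLength B 1))
          (cong (count P? [ [] ] +_) (count-listsOfLength-suc 0))
  count-listsUpTo-suc (suc R) = begin
    count P? (listsUpTo B (suc R) ++ listsOfLength B (suc (suc R)))
      ≡⟨ count-++ P? (listsUpTo B (suc R)) _ ⟩
    count P? (listsUpTo B (suc R)) + count P? (listsOfLength B (suc (suc R)))
      ≡⟨ cong₂ _+_ (count-listsUpTo-suc R) (count-listsOfLength-suc (suc R)) ⟩
    count P? [ [] ] + sum (map shorter (factors B)) + sum (map longest (factors B))
      ≡⟨ +-assoc (count P? [ [] ]) _ _ ⟩
    count P? [ [] ] + (sum (map shorter (factors B)) + sum (map longest (factors B)))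
      ≡⟨ cong (count P? [ [] ] +_) (sum-map-+ shorter longest (factors B)) ⟨
    count P? [ [] ] + sum (map (λ d → shorter d + longest d) (factors B))
      ≡⟨ cong (λ ns → count P? [ [] ] + sum ns)
              (map-cong (λ d → count-++ (P? ∘ (d ∷_)) (listsUpTo B R) _) (factors B)) ⟨
    count P? [ [] ] + sum (map (λ d → count (P? ∘ (d ∷_)) (listsUpTo B (suc R))) (factors B))
      ∎
    where
      open ≡-Reasoning
      shorter longest : ℕ → ℕ
      shorter d = count (P? ∘ (d ∷_)) (listsUpTo B R)
      longest d = count (P? ∘ (d ∷_)) (listsOfLength B (suc R))

factorisations : ℕ → ℕ → ℕ → ℕ
factorisations B R k = count (λ l → product l ≟ k) (listsUpTo B R)

factorisations-suc : ∀ B R k → factorisations B (suc R) k ≡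
  count (_≟ k) [ 1 ] + sum (map (λ d → count (λ l → d * product l ≟ k) (listsUpTo B R)) (factors B))
factorisations-suc B R k =
  trans (count-listsUpTo-suc (λ l → product l ≟ k) B R)
        (cong (_+ sum (map (λ d → count (λ l → d * product l ≟ k) (listsUpTo B R)) (factors B)))
              (count-[]-⇔ (λ l → product l ≟ k) (_≟ k) {[]} {1} (mk⇔ id id)))

module _ {d k : ℕ} where

  count-*-product : ∀ {q} .{{_ : NonZero d}} → k ≡ q * d → ∀ ls →
                    count (λ l → d * product l ≟ k) ls ≡ count (λ l → product l ≟ q) ls
  count-*-product {q} k≡q*d ls =
    count-cong (λ l → d * product l ≟ k) (λ l → product l ≟ q) {ls} λ _ → mk⇔
      (λ d*l≡k → *-cancelˡ-≡ _ q d (trans d*l≡k (trans k≡q*d (*-comm q d))))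
      (λ l≡q → trans (cong (d *_) l≡q) (trans (*-comm d q) (sym k≡q*d)))

  count-*-product-∤ : ¬ d ∣ k → ∀ ls → count (λ l → d * product l ≟ k) ls ≡ 0
  count-*-product-∤ d∤k ls =
    count-none (λ l → d * product l ≟ k) {ls} λ {l} _ d*l≡k →
      d∤k (divides (product l) (trans (sym d*l≡k) (*-comm d (product l))))

squareFree? : Decidable SquareFree
squareFree? zero      = no λ sf → contradiction (sf 2 (divides 0 refl)) λ ()
squareFree? n@(suc _) =
  map′ (λ h d dd∣n → h (s≤s (∣⇒≤ (∣-trans (m∣m*n d) dd∣n))) dd∣n)
       (λ sf {d} _ → sf d)
       (allUpTo? (λ d → d * d ∣? n →-dec d ≟ 1) (suc n))

squareFree-1 : SquareFree 1
squareFree-1 d dd∣1 = ∣1⇒≡1 (∣-trans (m∣m*n d) dd∣1)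

squareFree-∣ : ∀ {m n} → m ∣ n → SquareFree n → SquareFree m
squareFree-∣ m∣n sf d dd∣m = sf d (∣-trans dd∣m m∣n)

squareFree-* : ∀ {p q} → Prime p → ¬ p ∣ q → SquareFree q → SquareFree (p * q)
squareFree-* {p} {q} p-prime p∤q sf d dd∣pq@(divides c pq≡c*dd)
  with euclidsLemma c (d * d) p-prime (divides q (trans (sym pq≡c*dd) (*-comm p q)))
... | inj₁ p∣c  =
  sf d (*-cancelˡ-∣ p (subst (p * (d * d) ∣_) (sym pq≡c*dd) (*-monoˡ-∣ (d * d) p∣c)))
  where instance _ = prime⇒nonZero p-prime
... | inj₂ p∣dd = contradiction (*-cancelˡ-∣ p (∣-trans (*-pres-∣ p∣d p∣d) dd∣pq)) p∤q
  where
    instance _ = prime⇒nonZero p-prime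
    p∣d = reduce (euclidsLemma d d p-prime p∣dd)

primeDivisor : ∀ {n} .{{_ : NonZero n}} → 1 < n → ∃[ p ] Prime p × p ∣ n
primeDivisor {n} 1<n with factorise n
... | record { factors = [] ; isFactorisation = n≡1 } = contradiction n≡1 (>⇒≢ 1<n)
... | record { factors = p ∷ ps ; isFactorisation = n≡Π ; factorsPrime = p-prime ∷ _ } =
  p , p-prime , subst (p ∣_) (sym n≡Π) (∈⇒∣product {ns = p ∷ ps} (here refl))

SquareFreeCofactor : ℕ → Pred ℕ 0ℓ
SquareFreeCofactor k d = ∃[ q ] q * d ≡ k × SquareFree q

module _ {k} .{{_ : NonZero k}} where

  cofactor≢0 : ∀ {q d} → q * d ≡ k → NonZero d
  cofactor≢0 {q} refl = m*n≢0⇒n≢0 q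

  squareFreeCofactor⇔ : ∀ {q d} → q * d ≡ k → SquareFreeCofactor k d ⇔ SquareFree q
  squareFreeCofactor⇔ {q} {d} q*d≡k = mk⇔
    (λ (q′ , q′*d≡k , sf) → subst SquareFree (q′≡q q′*d≡k) sf)
    (λ sf → q , q*d≡k , sf)
    where
      q′≡q : ∀ {q′} → q′ * d ≡ k → q′ ≡ q
      q′≡q q′*d≡k = *-cancelʳ-≡ _ q d {{cofactor≢0 {q} q*d≡k}} (trans q′*d≡k (sym q*d≡k))

  squareFreeCofactor? : Decidable (SquareFreeCofactor k)
  squareFreeCofactor? d with d ∣? k
  ... | no d∤k                = no λ (q , q*d≡k , _) → d∤k (divides q (sym q*d≡k))
  ... | yes (divides q k≡q*d) = map′ from to (squareFree? q)
    where open Equivalence (squareFreeCofactor⇔ {q} {d} (sym k≡q*d))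

module CofactorToggle {k p} .{{_ : NonZero k}} (p-prime : Prime p) (p∣k : p ∣ k) where

  private instance
    p≢0 : NonZero p
    p≢0 = prime⇒nonZero p-prime

  -- d * p ∣ k says that p divides the cofactor k / d.
  toggle : ℕ → ℕ
  toggle d = if does (d * p ∣? k) then d * p else d / p

  private

    *p≢id : ∀ {e} → NonZero e → e * p ≢ e
    *p≢id {e} e≢0 e*p≡e =
      <-irrefl (sym e*p≡e) (m<m*n e p {{e≢0}} (nonTrivial⇒n>1 p {{prime⇒nonTrivial p-prime}}))

    toggle-pair : ∀ e r → r * p * e ≡ k → SquareFree (r * p) →
                toggle e ≡ e * p × toggle (e * p) ≡ e × SquareFreeCofactor k (e * p)
    toggle-pair e r rp*e≡k sf =
      toggle-up , toggle-down , (r , r*ep≡k , squareFree-∣ (m∣m*n p) sf)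
      where
        instance
          e≢0 : NonZero e
          e≢0 = cofactor≢0 {q = r * p} rp*e≡k
        r*ep≡k : r * (e * p) ≡ k
        r*ep≡k = trans (cong (r *_) (*-comm e p)) (trans (sym (*-assoc r p e)) rp*e≡k)
        ep*p∤k : ¬ e * p * p ∣ k
        ep*p∤k ep*p∣k =
          nonTrivial⇒≢1 {{prime⇒nonTrivial p-prime}} (sf p (*-cancelʳ-∣ e pp*e∣rp*e))
          where
            pp*e∣rp*e : p * p * e ∣ r * p * e
            pp*e∣rp*e = subst₂ _∣_ (trans (*-assoc e p p) (*-comm e (p * p))) (sym rp*e≡k) ep*p∣k
        toggle-up : toggle e ≡ e * p
        toggle-up = cong (λ b → if b then e * p else e / p)
                         (dec-true (e * p ∣? k) (divides r (sym r*ep≡k)))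
        toggle-down : toggle (e * p) ≡ e
        toggle-down = trans (cong (λ b → if b then e * p * p else e * p / p)
                                  (dec-false (e * p * p ∣? k) ep*p∤k))
                            (m*n/n≡m e p)

    toggle-orbit : ∀ {d} → SquareFreeCofactor k d →
                   SquareFreeCofactor k (toggle d) × toggle d ≢ d × toggle (toggle d) ≡ d
    toggle-orbit {d} (q , q*d≡k , sf) with p ∣? q
    ... | yes (divides r refl) =
      let up , down , cofactor[dp] = toggle-pair d r q*d≡k sf in
      subst (SquareFreeCofactor k) (sym up) cofactor[dp] ,
      (λ toggle[d]≡d → *p≢id (cofactor≢0 {q = q} q*d≡k) (trans (sym up) toggle[d]≡d)) ,
      trans (cong toggle up) down
    ... | no p∤q with euclidsLemma q d p-prime (subst (p ∣_) (sym q*d≡k) p∣k)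
    ...   | inj₁ p∣q               = contradiction p∣q p∤q
    ...   | inj₂ (divides d′ refl) =
      let up , down , _ = toggle-pair d′ q qp*d′≡k sf′ in
      subst (SquareFreeCofactor k) (sym down) (q * p , qp*d′≡k , sf′) ,
      (λ toggle[d]≡d → *p≢id (cofactor≢0 {q = q * p} qp*d′≡k)
                             (sym (trans (sym down) toggle[d]≡d))) ,
      trans (cong toggle down) up
      where
        qp*d′≡k : q * p * d′ ≡ k
        qp*d′≡k = trans (*-assoc q p d′) (trans (cong (q *_) (*-comm p d′)) q*d≡k)
        sf′ : SquareFree (q * p)
        sf′ = subst SquareFree (*-comm p q) (squareFree-* p-prime p∤q sf)

  toggle-involution : IsFixedPointFreeInvolutionOn (SquareFreeCofactor k) toggle
  toggle-involution = record
    { closed         = λ h → proj₁ (toggle-orbit h)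
    ; fixedPointFree = λ h → proj₁ (proj₂ (toggle-orbit h))
    ; involutive     = λ h → proj₂ (proj₂ (toggle-orbit h))
    }

squareFreeCofactors-even : ∀ {k B} .{{_ : NonZero k}} → 1 < k → k ≤ B →
                           parity (count (squareFreeCofactor? {k}) (upTo (suc B))) ≡ 0ℙ
squareFreeCofactors-even {k} {B} 1<k k≤B with p , p-prime , p∣k ← primeDivisor 1<k =
  involution⇒count-even _≟_ (upTo⁺ (suc B)) squareFreeCofactor? (toggle-involution p-prime p∣k)
    λ (q , q*d≡k , _) → ∈-upTo⁺ (s≤s (≤-trans (∣⇒≤ (divides q (sym q*d≡k))) k≤B))
  where open CofactorToggle

squareFreeCofactors-parity : ∀ {k B} .{{_ : NonZero k}} → k ≤ B →
                             parity (count (_≟ k) [ 1 ] + count (squareFreeCofactor? {k}) (factors B))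
                             ≡ parity (count squareFree? [ k ])
squareFreeCofactors-parity {1} {B} _ = begin
  parity (1 + count squareFreeCofactor? (factors B))
    ≡⟨ cong (parity ∘ suc) (count-none squareFreeCofactor? no-cofactor) ⟩
  parity 1
    ≡⟨ cong parity (count-yes squareFree? squareFree-1) ⟨
  parity (count squareFree? [ 1 ])
    ∎
  where
    open ≡-Reasoning
    no-cofactor : ∀ {d} → d ∈ factors B → ¬ SquareFreeCofactor 1 d
    no-cofactor d∈ (q , q*d≡1 , _) =
      contradiction (∣1⇒≡1 (divides q (sym q*d≡1))) (>⇒≢ (∈-factors⁻ {B} d∈))
squareFreeCofactors-parity {k@(suc (suc _))} {B} k≤B =
  parity-+≡0ℙ⇒≡ (count squareFree? [ k ]) (count sfc? (factors B))
    (trans (cong parity (sym split)) (squareFreeCofactors-even (s≤s (s≤s z≤n)) k≤B))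
  where
    open ≡-Reasoning
    sfc? = squareFreeCofactor? {k}
    split : count sfc? (upTo (suc B)) ≡ count squareFree? [ k ] + count sfc? (factors B)
    split = begin
      count sfc? (upTo (suc B))
        ≡⟨ cong (count sfc?) (upTo-suc≡0∷1∷factors (≤-trans (s≤s z≤n) k≤B)) ⟩
      count sfc? (0 ∷ 1 ∷ factors B)
        ≡⟨ count-∷ sfc? 0 (1 ∷ factors B) ⟩
      count sfc? [ 0 ] + count sfc? (1 ∷ factors B)
        ≡⟨ cong₂ _+_ (count-no sfc? λ (q , q*0≡k , _) → 0≢1+n (trans (sym (*-zeroʳ q)) q*0≡k))
                     (count-∷ sfc? 1 (factors B)) ⟩
      count sfc? [ 1 ] + count sfc? (factors B)
        ≡⟨ cong (_+ count sfc? (factors B))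
                (count-[]-⇔ sfc? squareFree? {1} {k} (squareFreeCofactor⇔ (*-identityʳ k))) ⟩
      count squareFree? [ k ] + count sfc? (factors B)
        ∎

parity-factorisations-suc :
  ∀ {B R k} .{{_ : NonZero k}} → k ≤ B →
  (∀ {q} .{{_ : NonZero q}} → q < k → parity (factorisations B R q) ≡ parity (count squareFree? [ q ])) →
  parity (factorisations B (suc R) k) ≡ parity (count squareFree? [ k ])
parity-factorisations-suc {B} {R} {k} k≤B ih = begin
  parity (factorisations B (suc R) k)
    ≡⟨ cong parity (factorisations-suc B R k) ⟩
  parity (empty + sum (map term (factors B)))
    ≡⟨ +-homo-+ empty _ ⟩
  parity empty ℙ.+ parity (sum (map term (factors B)))
    ≡⟨ cong (parity empty ℙ.+_) (parity-sum-cong λ d∈ → parity-term (∈-factors⁻ {B} d∈) (_ ∣? k)) ⟩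
  parity empty ℙ.+ parity (sum (map (λ d → count sfc? [ d ]) (factors B)))
    ≡⟨ cong (λ n → parity empty ℙ.+ parity n) (count≡sum sfc? (factors B)) ⟨
  parity empty ℙ.+ parity (count sfc? (factors B))
    ≡⟨ +-homo-+ empty _ ⟨
  parity (empty + count sfc? (factors B))
    ≡⟨ squareFreeCofactors-parity k≤B ⟩
  parity (count squareFree? [ k ])
    ∎
  where
    open ≡-Reasoning
    empty = count (_≟ k) [ 1 ]
    sfc?  = squareFreeCofactor? {k}
    term : ℕ → ℕ
    term d = count (λ l → d * product l ≟ k) (listsUpTo B R)
    parity-term : ∀ {d} → 2 ≤ d → Dec (d ∣ k) → parity (term d) ≡ parity (count sfc? [ d ])
    parity-term _ (no d∤k) = cong parity (trans
      (count-*-product-∤ d∤k (listsUpTo B R))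
      (sym (count-no sfc? λ (q , q*d≡k , _) → d∤k (divides q (sym q*d≡k)))))
    parity-term {d} 2≤d (yes (divides q k≡q*d)) = begin
      parity (term d)
        ≡⟨ cong parity (count-*-product {{d≢0}} k≡q*d (listsUpTo B R)) ⟩
      parity (factorisations B R q)
        ≡⟨ ih {{q≢0}} q<k ⟩
      parity (count squareFree? [ q ])
        ≡⟨ cong parity (count-[]-⇔ sfc? squareFree? {d} {q} (squareFreeCofactor⇔ (sym k≡q*d))) ⟨
      parity (count sfc? [ d ])
        ∎
      where
        d≢0 = cofactor≢0 {q = q} (sym k≡q*d)
        q≢0 = cofactor≢0 {q = d} (trans (*-comm d q) (sym k≡q*d))
        q<k : q < k
        q<k = subst (q <_) (sym k≡q*d) (m<m*n q d {{q≢0}} 2≤d)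

parity-factorisations : ∀ {B} R {k} .{{_ : NonZero k}} → k ≤ B → k ≤ R →
                        parity (factorisations B R k) ≡ parity (count squareFree? [ k ])
parity-factorisations zero {k} _ k≤0 = contradiction (n≤0⇒n≡0 k≤0) (≢-nonZero⁻¹ k)
parity-factorisations (suc R) k≤B k≤1+R = parity-factorisations-suc {R = R} k≤B λ q<k →
  parity-factorisations R (≤-trans (<⇒≤ q<k) k≤B) (≤-pred (≤-trans q<k k≤1+R))

proposition13 : (n : ℕ) → (m (suc n) % 2 ≡ 1) ⇔ SquareFree (suc n)
proposition13 n =
  parity-count-[]⇔ squareFree? (suc n) ⇔-∘ (rewrite-parity ⇔-∘ %2≡1⇔parity≡1ℙ (m (suc n)))
  where
    parity[m]≡ : parity (m (suc n)) ≡ parity (count squareFree? [ suc n ])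
    parity[m]≡ = parity-factorisations (suc n) ≤-refl ≤-refl
    rewrite-parity : parity (m (suc n)) ≡ 1ℙ ⇔ parity (count squareFree? [ suc n ]) ≡ 1ℙ
    rewrite-parity = mk⇔ (trans (sym parity[m]≡)) (trans parity[m]≡)
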